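{- Let $m,t \in \mathbb N$ and $\delta >0$. There is $n_0$ such that the following holds for all $n\ge n_0$. Let $H$ be an $n$-vertex triple system, let $F \subseteq \partial H$, and for each $f \in F$ let $S_f \subseteq V(H)\setminus f$ with $|S_f|=m$. If $|F| \geq \delta n^{2}$, then there exists $K \subseteq F$ such that $K \cong K_{t,t}$ and $S_f \cap V(K)=\emptyset$ for each edge $f \in K$.
   Context: A triple system is a family of 3-element subsets of a vertex set $V(H)$; $\partial H$ is the graph consisting of all pairs contained in some edge of $H$.
   Formalization: The parameter δ ranges over the positive rationals. -}

module Defs where

open import Data.Nat using (ℕ)
open import Data.Fin using (Fin)
open import Data.Fin.Subset using (Subset; _∈_; _⊆_; ∣_∣; _∪_; _∩_; ⁅_⁆; ⊥)
open import Data.List using (List)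
import Data.List.Membership.Propositional as L
open import Data.List.Relation.Unary.Unique.Propositional using (Unique)
open import Data.Product using (Σ; ∃; _×_)
open import Relation.Binary.PropositionalEquality using (_≡_; _≢_)

record TripleSystem (n : ℕ) : Set where
  field
    edges  : List (Subset n)
    unique : Unique edges
    size3  : ∀ {e} → e L.∈ edges → ∣ e ∣ ≡ 3
open TripleSystem public

_∈∂_ : ∀ {n} → Subset n → TripleSystem n → Set
f ∈∂ H = (∣ f ∣ ≡ 2) × ∃ λ e → (e L.∈ edges H) × (f ⊆ e)

pair : ∀ {n} → Fin n → Fin n → Subset n
pair a b = ⁅ a ⁆ ∪ ⁅ b ⁆

module Submission where

-- Only the graph F ⊆ ∂H matters.  Write adj u v for {u , v} ∈ F and
-- forb u v x for x ∈ S {u , v}.  By the handshake bound the density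
-- hypothesis gives Σ deg ≥ n² / (q + 1); the biclique is then built
-- greedily, every step being justified by averaging (the largest term of
-- a sum of n terms is at least the mean):
--   * Phase 1 picks the left side A one vertex at a time, keeping a pool P
--     of common neighbours b of high degree such that S ab avoids A.  New
--     vertices are taken among the unpopular ones (those lying in few sets
--     S uv; by Markov all but L m are), so conflicts are rare and the pool
--     shrinks by at most a factor 2R per step.
--   * Phase 2 picks the right side B inside P one vertex at a time,
--     discarding the candidates in conflict with it; each step loses at
--     most 1 + 2 t m candidates.

open import Defs
open import Data.Nat using (ℕ; suc; _*_; _≤_; _≥_)
open import Data.Fin using (Fin)
open import Data.Fin.Subset using (Subset; _∈_; _⊆_; ∣_∣; _∪_; _∩_; ⊥)
open import Data.List using (List; length)
import Data.List.Membership.Propositional as L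
open import Data.List.Relation.Unary.Unique.Propositional using (Unique)
open import Data.Product using (Σ; ∃; _×_)
open import Relation.Binary.PropositionalEquality using (_≡_)

open import Data.Nat using (zero; _+_; _^_; _<_; z≤n; s≤s; NonZero; ≢-nonZero⁻¹; _≤ᵇ_; _≡ᵇ_)
open import Data.Nat.Properties hiding (_≟_)
open import Data.Nat.Tactic.RingSolver using (solve-∀)
open import Algebra.Properties.CommutativeSemigroup *-commutativeSemigroup using (x∙yz≈y∙xz)
open import Algebra.Properties.Semiring.Sum +-*-semiring
  using (sum; sum-cong-≗; ∑-comm; ∑-distrib-+; *-distribˡ-sum; *-distribʳ-sum)
open import Data.Bool using (Bool; true; false; _∧_; _∨_; not; T)
open import Data.Bool.Properties using () renaming (_≟_ to _≟ᵇ_)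
open import Data.Fin using (zero; suc)
open import Data.Fin.Properties using (_≟_)
open import Data.Fin.Subset using (_∉_; ⁅_⁆)
open import Data.Fin.Subset.Properties
  using (_∈?_; Empty-unique; x∈p∩q⁺; x∈p∩q⁻; x∈p∪q⁺; x∈p∪q⁻; ∉⊥; x∈⁅x⁆; ∪-idem; ∣⁅x⁆∣≡1; ∪-identityˡ)
open import Data.Vec using (tabulate) renaming ([] to []ᵛ; _∷_ to _∷ᵛ_)
open import Data.Vec.Properties using (lookup∘tabulate; []=⇒lookup; ≡-dec)
open import Data.List using ([]; _∷_)
open import Data.List.Relation.Unary.Any using (here; there; any?)
import Data.List.Relation.Unary.All as All
open import Data.List.Relation.Unary.AllPairs using (_∷_)
open import Data.Product using (∃₂; _,_; proj₁; proj₂)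
open import Data.Sum using (_⊎_; inj₁; inj₂)
open import Data.Empty using () renaming (⊥ to Empty)
open import Function using (_∘_; it)
open import Relation.Nullary using (Dec; yes; no; does; contradiction)
open import Relation.Nullary.Decidable using (dec-true; dec-false)
open import Relation.Binary.PropositionalEquality
  using (_≢_; refl; sym; trans; cong; cong₂; subst; module ≡-Reasoning)

⟦_⟧ : Bool → ℕ
⟦ true ⟧  = 1
⟦ false ⟧ = 0

⟦⟧≤1 : ∀ b → ⟦ b ⟧ ≤ 1
⟦⟧≤1 true  = ≤-refl
⟦⟧≤1 false = z≤n

⟦⟧≡0 : ∀ {b} → ⟦ b ⟧ ≡ 0 → b ≡ false
⟦⟧≡0 {false} _ = refl

⟦∧⟧ : ∀ x y → ⟦ x ∧ y ⟧ ≡ ⟦ x ⟧ * ⟦ y ⟧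
⟦∧⟧ true  true  = refl
⟦∧⟧ true  false = refl
⟦∧⟧ false _     = refl

∧-true : ∀ {x y} → x ∧ y ≡ true → x ≡ true × y ≡ true
∧-true {true} {true} _ = refl , refl

∨-false : ∀ {x y} → x ∨ y ≡ false → x ≡ false × y ≡ false
∨-false {false} {false} _ = refl , refl

not-true : ∀ {x} → not x ≡ true → x ≡ false
not-true {false} _ = refl

≡ᵇ0⇒≡0 : ∀ c → (c ≡ᵇ 0) ≡ true → c ≡ 0
≡ᵇ0⇒≡0 zero _ = refl

positive-indicator : ∀ {N} .{{_ : NonZero N}} b x → N ≤ ⟦ b ⟧ * x → b ≡ true × N ≤ x
positive-indicator true  x N≤x = refl , subst (_ ≤_) (+-identityʳ x) N≤x
positive-indicator {N} false x N≤0 = contradiction (n≤0⇒n≡0 N≤0) (≢-nonZero⁻¹ N)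

-- Filtering by a vanishing conflict count: a pair counted on the left
-- either survives the filter or is charged to the count c.
filter-split : ∀ x y c → ⟦ x ∧ y ⟧ ≤ ⟦ x ∧ (y ∧ (c ≡ᵇ 0)) ⟧ + ⟦ x ∧ y ⟧ * c
filter-split false y     c       = z≤n
filter-split true  false c       = z≤n
filter-split true  true  zero    = s≤s z≤n
filter-split true  true  (suc c) = s≤s z≤n

sum-mono : ∀ {n} {f g : Fin n → ℕ} → (∀ i → f i ≤ g i) → sum f ≤ sum g
sum-mono {zero}  _ = z≤n
sum-mono {suc n} h = +-mono-≤ (h zero) (sum-mono (h ∘ suc))

sum-const : ∀ {n} c → sum {n} (λ _ → c) ≡ n * c
sum-const {zero}  c = refl
sum-const {suc n} c = cong (c +_) (sum-const {n} c)

sum-bound : ∀ {n} {f : Fin n → ℕ} c → (∀ i → f i ≤ c) → sum f ≤ n * c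
sum-bound {n} c h = ≤-trans (sum-mono h) (≤-reflexive (sum-const {n} c))

term≤sum : ∀ {n} (f : Fin n → ℕ) i → f i ≤ sum f
term≤sum f zero    = m≤m+n _ _
term≤sum f (suc i) = ≤-trans (term≤sum (f ∘ suc) i) (m≤n+m _ _)

argmax : ∀ {n} {{_ : NonZero n}} (f : Fin n → ℕ) → ∃ λ i → ∀ j → f j ≤ f i
argmax {suc zero} f = zero , λ { zero → ≤-refl }
argmax {suc (suc n)} f with argmax (f ∘ suc)
... | i , max with f zero ≤? f (suc i)
...   | yes z≤i = suc i , λ { zero → z≤i ; (suc j) → max j }
...   | no  z≰i = zero  , λ { zero → ≤-refl ; (suc j) → ≤-trans (max j) (≰⇒≥ z≰i) }

∑∑-distrib-+ : ∀ {m n} (g h : Fin m → Fin n → ℕ) →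
  sum (λ u → sum (λ v → g u v + h u v)) ≡ sum (λ u → sum (g u)) + sum (λ u → sum (h u))
∑∑-distrib-+ g h = trans (sum-cong-≗ (λ u → ∑-distrib-+ (g u) (h u)))
                         (∑-distrib-+ (λ u → sum (g u)) (λ u → sum (h u)))

∑-rotate : ∀ {k l n} (f : Fin k → Fin l → Fin n → ℕ) →
  sum (λ a → sum (λ v → sum (λ b → f a v b))) ≡ sum (λ v → sum (λ b → sum (λ a → f a v b)))
∑-rotate f = trans (∑-comm (λ a v → sum (f a v))) (sum-cong-≗ (λ v → ∑-comm (λ a b → f a v b)))

count : ∀ {n} → (Fin n → Bool) → ℕ
count P = sum (λ i → ⟦ P i ⟧)

count≤n : ∀ {n} (P : Fin n → Bool) → count P ≤ n
count≤n {n} P = ≤-trans (sum-bound 1 (⟦⟧≤1 ∘ P)) (≤-reflexive (*-identityʳ n))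

count≡0 : ∀ {n} (P : Fin n → Bool) → count P ≡ 0 → ∀ i → P i ≡ false
count≡0 P c≡0 i with P i | term≤sum (λ j → ⟦ P j ⟧) i
... | false | _   = refl
... | true  | 1≤c = contradiction (subst (1 ≤_) c≡0 1≤c) λ ()

count-∧≡0 : ∀ {n} (A p : Fin n → Bool) → count (λ a → A a ∧ p a) ≡ 0 → ∀ {a} → A a ≡ true → p a ≡ false
count-∧≡0 A p none {a} a∈A with count≡0 (λ a → A a ∧ p a) none a
... | Ap≡false rewrite a∈A = Ap≡false

count-∧ˡ : ∀ {n} x (P : Fin n → Bool) → count (λ i → x ∧ P i) ≡ ⟦ x ⟧ * count P
count-∧ˡ x P = begin
  sum (λ i → ⟦ x ∧ P i ⟧)   ≡⟨ sum-cong-≗ (λ i → ⟦∧⟧ x (P i)) ⟩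
  sum (λ i → ⟦ x ⟧ * ⟦ P i ⟧) ≡⟨ *-distribˡ-sum ⟦ x ⟧ (λ i → ⟦ P i ⟧) ⟨
  ⟦ x ⟧ * count P ∎
  where open ≡-Reasoning

sum-on-support : ∀ {n} (P : Fin n → Bool) {f : Fin n → ℕ} c →
  (∀ i → P i ≡ true → f i ≤ c) → sum (λ i → ⟦ P i ⟧ * f i) ≤ count P * c
sum-on-support P {f} c bound = begin
  sum (λ i → ⟦ P i ⟧ * f i) ≤⟨ sum-mono term ⟩
  sum (λ i → ⟦ P i ⟧ * c)   ≡⟨ *-distribʳ-sum c (λ i → ⟦ P i ⟧) ⟨
  count P * c               ∎
  where
  open ≤-Reasoning
  term : ∀ i → ⟦ P i ⟧ * f i ≤ ⟦ P i ⟧ * c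
  term i with P i in eq
  ... | true  = *-monoʳ-≤ 1 (bound i eq)
  ... | false = z≤n

markov : ∀ {n} θ K (f : Fin n → ℕ) → θ * count (λ i → θ ≤ᵇ K * f i) ≤ K * sum f
markov θ K f = begin
  θ * count (λ i → θ ≤ᵇ K * f i)   ≡⟨ *-distribˡ-sum θ (λ i → ⟦ θ ≤ᵇ K * f i ⟧) ⟩
  sum (λ i → θ * ⟦ θ ≤ᵇ K * f i ⟧) ≤⟨ sum-mono (λ i → term (K * f i)) ⟩
  sum (λ i → K * f i)                     ≡⟨ *-distribˡ-sum K f ⟨
  K * sum f                               ∎
  where
  open ≤-Reasoning
  term : ∀ x → θ * ⟦ θ ≤ᵇ x ⟧ ≤ x
  term x with θ ≤ᵇ x in θ≤x
  ... | true  = ≤-trans (≤-reflexive (*-identityʳ θ)) (≤ᵇ⇒≤ θ x (subst T (sym θ≤x) _))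
  ... | false = subst (_≤ x) (sym (*-zeroʳ θ)) z≤n

count-singleton : ∀ {n} (v : Fin n) → count (λ x → does (x ≟ v)) ≡ 1
count-singleton {suc n} zero    = cong suc (trans (sum-const {n} 0) (*-zeroʳ n))
count-singleton {suc n} (suc v) = count-singleton v

count-∨ : ∀ {n} (P Q : Fin n → Bool) → count (λ i → P i ∨ Q i) ≤ count P + count Q
count-∨ P Q = ≤-trans (sum-mono (λ i → term (P i) (Q i)))
                      (≤-reflexive (∑-distrib-+ (λ i → ⟦ P i ⟧) (λ i → ⟦ Q i ⟧)))
  where
  term : ∀ p q → ⟦ p ∨ q ⟧ ≤ ⟦ p ⟧ + ⟦ q ⟧
  term true  q = s≤s z≤n
  term false q = ≤-refl

insert : ∀ {n} → Fin n → (Fin n → Bool) → Fin n → Bool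
insert v A x = does (x ≟ v) ∨ A x

∈-insert : ∀ {n} (v : Fin n) A x → insert v A x ≡ true → x ≡ v ⊎ A x ≡ true
∈-insert v A x h with x ≟ v
... | yes x≡v = inj₁ x≡v
... | no  _   = inj₂ h

count-insert : ∀ {n} v (A : Fin n → Bool) → A v ≡ false → count (insert v A) ≡ suc (count A)
count-insert v A v∉A = begin
  count (insert v A)                              ≡⟨ sum-cong-≗ split ⟩
  sum (λ x → ⟦ does (x ≟ v) ⟧ + ⟦ A x ⟧)          ≡⟨ ∑-distrib-+ (λ x → ⟦ does (x ≟ v) ⟧) (λ x → ⟦ A x ⟧) ⟩
  count (λ x → does (x ≟ v)) + count A            ≡⟨ cong (_+ count A) (count-singleton v) ⟩
  suc (count A)                                   ∎
  where
  open ≡-Reasoning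
  split : ∀ x → ⟦ insert v A x ⟧ ≡ ⟦ does (x ≟ v) ⟧ + ⟦ A x ⟧
  split x with x ≟ v
  ... | yes refl rewrite v∉A = refl
  ... | no  _    = refl

absorb : ∀ N W g e₁ e₂ .{{_ : NonZero N}} → N * N ≤ W * (N * g + e₁ + e₂) →
  4 * (W * e₁) ≤ N * N → 4 * (W * e₂) ≤ N * N → N ≤ 2 * W * g
absorb N W g e₁ e₂ main small₁ small₂ =
  *-cancelˡ-≤ N (*-cancelˡ-≤ 2 (+-cancelʳ-≤ (2 * (N * N)) _ _ doubled))
  where
  open ≤-Reasoning
  expand : ∀ N W g e₁ e₂ → 4 * (W * (N * g + e₁ + e₂)) ≡ 2 * (N * (2 * W * g)) + 4 * (W * e₁) + 4 * (W * e₂)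
  expand = solve-∀
  halves : ∀ x → 4 * x ≡ 2 * x + 2 * x
  halves = solve-∀
  regroup : ∀ a x → a + x + x ≡ a + 2 * x
  regroup = solve-∀
  doubled : 2 * (N * N) + 2 * (N * N) ≤ 2 * (N * (2 * W * g)) + 2 * (N * N)
  doubled = begin
    2 * (N * N) + 2 * (N * N)                            ≡⟨ halves (N * N) ⟨
    4 * (N * N)                                          ≤⟨ *-monoʳ-≤ 4 main ⟩
    4 * (W * (N * g + e₁ + e₂))                          ≡⟨ expand N W g e₁ e₂ ⟩
    2 * (N * (2 * W * g)) + 4 * (W * e₁) + 4 * (W * e₂)  ≤⟨ +-mono-≤ (+-monoʳ-≤ _ small₁) small₂ ⟩
    2 * (N * (2 * W * g)) + N * N + N * N                ≡⟨ regroup _ (N * N) ⟩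
    2 * (N * (2 * W * g)) + 2 * (N * N)                  ∎

square-cancel : ∀ a c → a * a ≤ a * c → a ≤ c
square-cancel zero    c _ = z≤n
square-cancel (suc a) c h = *-cancelˡ-≤ (suc a) h

-- Pool sizes of the first phase: the pool shrinks by a factor 2R per
-- step, so after k steps it has at least n / pool-const R k points.
pool-const : ℕ → ℕ → ℕ
pool-const R k = R * (2 * R) ^ k

pool-const-suc : ∀ R k → 2 * (R * pool-const R k) ≡ pool-const R (suc k)
pool-const-suc R k = reorder R ((2 * R) ^ k)
  where
  reorder : ∀ R x → 2 * (R * (R * x)) ≡ R * (2 * R * x)
  reorder = solve-∀

pool-const-mono : ∀ R {{_ : NonZero R}} {k t} → k ≤ t → pool-const R k ≤ pool-const R t
pool-const-mono R k≤t = *-monoʳ-≤ R (^-monoʳ-≤ (2 * R) {{m*n≢0 2 R}} k≤t)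

pool-const-nonZero : ∀ R {{_ : NonZero R}} k → NonZero (pool-const R k)
pool-const-nonZero R k = m*n≢0 R ((2 * R) ^ k) {{it}} {{m^n≢0 (2 * R) k {{m*n≢0 2 R}}}}

∣tabulate∣ : ∀ {n} (P : Fin n → Bool) → ∣ tabulate P ∣ ≡ count P
∣tabulate∣ {zero}  P = refl
∣tabulate∣ {suc n} P with P zero
... | true  = cong suc (∣tabulate∣ (P ∘ suc))
... | false = ∣tabulate∣ (P ∘ suc)

∈-tabulate : ∀ {n} (P : Fin n → Bool) {x} → x ∈ tabulate P → P x ≡ true
∈-tabulate P {x} x∈P = trans (sym (lookup∘tabulate P x)) ([]=⇒lookup x∈P)

∣∣≡count : ∀ {n} (s : Subset n) → ∣ s ∣ ≡ count (λ x → does (x ∈? s))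
∣∣≡count []ᵛ          = refl
∣∣≡count (true  ∷ᵛ s) = cong suc (∣∣≡count s)
∣∣≡count (false ∷ᵛ s) = ∣∣≡count s

∩≡⊥ : ∀ {n} (s t : Subset n) → (∀ {x} → x ∈ s → x ∈ t → Empty) → s ∩ t ≡ ⊥
∩≡⊥ s t apart = Empty-unique λ { (x , x∈s∩t) → let (x∈s , x∈t) = x∈p∩q⁻ s t x∈s∩t in apart x∈s x∈t }

∉-disjoint : ∀ {n} {s f : Subset n} {x} → s ∩ f ≡ ⊥ → x ∈ f → x ∉ s
∉-disjoint s∩f≡⊥ x∈f x∈s = ∉⊥ (subst (_ ∈_) s∩f≡⊥ (x∈p∩q⁺ (x∈s , x∈f)))

∈pair₁ : ∀ {n} (a b : Fin n) → a ∈ pair a b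
∈pair₁ a b = x∈p∪q⁺ (inj₁ (x∈⁅x⁆ a))

∈pair₂ : ∀ {n} (a b : Fin n) → b ∈ pair a b
∈pair₂ a b = x∈p∪q⁺ (inj₂ (x∈⁅x⁆ b))

pair-distinct : ∀ {n} {a b : Fin n} → ∣ pair a b ∣ ≡ 2 → a ≢ b
pair-distinct {a = a} size refl = contradiction (trans (sym size) (trans (cong ∣_∣ (∪-idem ⁅ a ⁆)) (∣⁅x⁆∣≡1 a))) λ ()

size0⇒⊥ : ∀ {n} (s : Subset n) → ∣ s ∣ ≡ 0 → s ≡ ⊥
size0⇒⊥ []ᵛ          _ = refl
size0⇒⊥ (false ∷ᵛ s) h = cong (false ∷ᵛ_) (size0⇒⊥ s h)

size1⇒singleton : ∀ {n} (s : Subset n) → ∣ s ∣ ≡ 1 → ∃ λ u → ⁅ u ⁆ ≡ s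
size1⇒singleton (true  ∷ᵛ s) h = zero , cong (true ∷ᵛ_) (sym (size0⇒⊥ s (suc-injective h)))
size1⇒singleton (false ∷ᵛ s) h with size1⇒singleton s h
... | u , ⁅u⁆≡s = suc u , cong (false ∷ᵛ_) ⁅u⁆≡s

size2⇒pair : ∀ {n} (s : Subset n) → ∣ s ∣ ≡ 2 → ∃₂ λ u v → pair u v ≡ s
size2⇒pair (true  ∷ᵛ s) h with size1⇒singleton s (suc-injective h)
... | v , ⁅v⁆≡s = zero , suc v , cong (true ∷ᵛ_) (trans (∪-identityˡ ⁅ v ⁆) ⁅v⁆≡s)
size2⇒pair (false ∷ᵛ s) h with size2⇒pair s h
... | u , v , uv≡s = suc u , suc v , cong (false ∷ᵛ_) uv≡s

_≟ˢ_ : ∀ {n} (s t : Subset n) → Dec (s ≡ t)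
_≟ˢ_ = ≡-dec _≟ᵇ_

_∈ˡ?_ : ∀ {n} (s : Subset n) (F : List (Subset n)) → Dec (s L.∈ F)
s ∈ˡ? F = any? (s ≟ˢ_) F

∈ˡ-sound : ∀ {n} {s : Subset n} {F} → does (s ∈ˡ? F) ≡ true → s L.∈ F
∈ˡ-sound {s = s} {F} h with s ∈ˡ? F
... | yes s∈F = s∈F

handshake : ∀ {n} (F : List (Subset n)) → Unique F →
  (∀ {f} → f L.∈ F → ∃₂ λ u v → pair u v ≡ f) →
  length F ≤ sum (λ u → count (λ v → does (pair u v ∈ˡ? F)))
handshake []      _            _     = z≤n
handshake (f ∷ F) (f∉F ∷ uniq) pairs with pairs (here refl)
... | u₀ , v₀ , refl = begin
  1 + length F
    ≤⟨ +-mono-≤ hit (handshake F uniq (pairs ∘ there)) ⟩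
  sum (λ u → count (λ v → is-f u v)) + sum (λ u → count (λ v → does (pair u v ∈ˡ? F)))
    ≡⟨ ∑∑-distrib-+ (λ u v → ⟦ is-f u v ⟧) (λ u v → ⟦ does (pair u v ∈ˡ? F) ⟧) ⟨
  sum (λ u → sum (λ v → ⟦ is-f u v ⟧ + ⟦ does (pair u v ∈ˡ? F) ⟧))
    ≤⟨ sum-mono (λ u → sum-mono (λ v → split (pair u v))) ⟩
  sum (λ u → count (λ v → does (pair u v ∈ˡ? (f ∷ F))))  ∎
  where
  open ≤-Reasoning
  is-f : Fin _ → Fin _ → Bool
  is-f u v = does (pair u v ≟ˢ pair u₀ v₀)
  hit : 1 ≤ sum (λ u → count (λ v → is-f u v))
  hit = ≤-trans (≤-reflexive (cong ⟦_⟧ (sym (dec-true (pair u₀ v₀ ≟ˢ pair u₀ v₀) refl))))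
                (≤-trans (term≤sum (λ v → ⟦ is-f u₀ v ⟧) v₀) (term≤sum (λ u → count (is-f u)) u₀))
  -- f itself is not repeated in F.
  split : ∀ s → ⟦ does (s ≟ˢ pair u₀ v₀) ⟧ + ⟦ does (s ∈ˡ? F) ⟧ ≤ ⟦ does (s ∈ˡ? (pair u₀ v₀ ∷ F)) ⟧
  split s with s ≟ˢ pair u₀ v₀
  ... | no _ = ≤-refl
  ... | yes refl with s ∈ˡ? F
  ...   | yes s∈F = contradiction refl (All.lookup f∉F s∈F)
  ...   | no  _   = ≤-refl

module Greedy
  {n : ℕ} {{_ : NonZero n}}
  (adj  : Fin n → Fin n → Bool)
  (forb : Fin n → Fin n → Fin n → Bool)
  (m    : ℕ)
  (forb-size : ∀ u v → count (forb u v) ≤ m)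
  (forb-end₁ : ∀ u v → forb u v u ≡ false)
  (forb-end₂ : ∀ u v → forb u v v ≡ false)
  where

  VSet : Set
  VSet = Fin n → Bool

  deg : Fin n → ℕ
  deg b = count (λ v → adj v b)

  record Biclique (A B : VSet) : Set where
    field
      edge    : ∀ {a b} → A a ≡ true → B b ≡ true → adj a b ≡ true
      avoidsA : ∀ {a b x} → A a ≡ true → B b ≡ true → A x ≡ true → forb a b x ≡ false
      avoidsB : ∀ {a b x} → A a ≡ true → B b ≡ true → B x ≡ true → forb a b x ≡ false

  -- The first phase: R controls the degrees in the pool, L the popularity
  -- threshold.
  module Phase₁ (R L : ℕ) {{_ : NonZero R}} where

    pop : Fin n → ℕ
    pop a = sum (λ v → count (λ b → forb v b a))

    popular : Fin n → Bool
    popular a = n * n ≤ᵇ L * pop a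

    unpopular : ∀ {a} → popular a ≡ false → L * pop a < n * n
    unpopular {a} h = ≰⇒> λ le → subst T h (≤⇒≤ᵇ le)

    -- Each forbidden set has at most m points, so Σ pop ≤ n² m and by
    -- Markov's inequality at most L m vertices are popular.
    popular-few : count popular ≤ L * m
    popular-few = *-cancelˡ-≤ (n * n) {{m*n≢0 n n}} (begin
      n * n * count popular    ≤⟨ markov (n * n) L pop ⟩
      L * sum pop              ≡⟨ cong (L *_) (∑-rotate (λ a v b → ⟦ forb v b a ⟧)) ⟩
      L * sum (λ v → sum (λ b → count (forb v b)))
                               ≤⟨ *-monoʳ-≤ L (sum-bound (n * m) (λ v → sum-bound m (forb-size v))) ⟩
      L * (n * (n * m))        ≡⟨ reorder L n m ⟩
      n * n * (L * m)          ∎)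
      where
      open ≤-Reasoning
      reorder : ∀ L n m → L * (n * (n * m)) ≡ n * n * (L * m)
      reorder = solve-∀

    record Stage₁ (A P : VSet) : Set where
      field
        high  : ∀ {b} → P b ≡ true → n ≤ R * deg b
        edge  : ∀ {a b} → A a ≡ true → P b ≡ true → adj a b ≡ true
        avoid : ∀ {a b x} → A a ≡ true → P b ≡ true → A x ≡ true → forb a b x ≡ false
        rare  : ∀ {a} → A a ≡ true → popular a ≡ false

    clash₁ : VSet → Fin n → Fin n → ℕ
    clash₁ A v b = count (λ a → A a ∧ forb a b v) + count (λ a → A a ∧ forb v b a)

    shrink₁ : VSet → VSet → Fin n → VSet
    shrink₁ A P v b = P b ∧ (adj v b ∧ (clash₁ A v b ≡ᵇ 0))

    blocked : VSet → Fin n → Bool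
    blocked A v = popular v ∨ A v

    stage₁-extend : ∀ {A P v} → Stage₁ A P → blocked A v ≡ false →
      Stage₁ (insert v A) (shrink₁ A P v)
    stage₁-extend {A} {P} {v} I free = record
      { high  = λ b∈ → high (pool b∈)
      ; edge  = edge′
      ; avoid = avoid′
      ; rare  = rare′ }
      where
      open Stage₁ I
      pool : ∀ {b} → shrink₁ A P v b ≡ true → P b ≡ true
      pool b∈ = proj₁ (∧-true b∈)
      adjacent : ∀ {b} → shrink₁ A P v b ≡ true → adj v b ≡ true
      adjacent {b} b∈ = proj₁ (∧-true {adj v b} (proj₂ (∧-true {P b} b∈)))
      no-clash : ∀ {b} → shrink₁ A P v b ≡ true → clash₁ A v b ≡ 0
      no-clash {b} b∈ = ≡ᵇ0⇒≡0 (clash₁ A v b) (proj₂ (∧-true {adj v b} (proj₂ (∧-true {P b} b∈))))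
      v-safe : ∀ {a b} → shrink₁ A P v b ≡ true → A a ≡ true → forb a b v ≡ false
      v-safe {b = b} b∈ = count-∧≡0 A (λ a → forb a b v) (m+n≡0⇒m≡0 _ (no-clash b∈))
      safe-v : ∀ {a b} → shrink₁ A P v b ≡ true → A a ≡ true → forb v b a ≡ false
      safe-v {b = b} b∈ = count-∧≡0 A (forb v b) (m+n≡0⇒n≡0 _ (no-clash b∈))
      edge′ : ∀ {a b} → insert v A a ≡ true → shrink₁ A P v b ≡ true → adj a b ≡ true
      edge′ {a} a∈ b∈ with ∈-insert v A a a∈
      ... | inj₁ refl = adjacent b∈
      ... | inj₂ a∈A  = edge a∈A (pool b∈)
      avoid′ : ∀ {a b x} → insert v A a ≡ true → shrink₁ A P v b ≡ true → insert v A x ≡ true →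
        forb a b x ≡ false
      avoid′ {a} {x = x} a∈ b∈ x∈ with ∈-insert v A a a∈ | ∈-insert v A x x∈
      ... | inj₁ refl | inj₁ refl = forb-end₁ _ _
      ... | inj₁ refl | inj₂ x∈A  = safe-v b∈ x∈A
      ... | inj₂ a∈A  | inj₁ refl = v-safe b∈ a∈A
      ... | inj₂ a∈A  | inj₂ x∈A  = avoid a∈A (pool b∈) x∈A
      rare′ : ∀ {a} → insert v A a ≡ true → popular a ≡ false
      rare′ {a} a∈ with ∈-insert v A a a∈
      ... | inj₁ refl = proj₁ (∨-false free)
      ... | inj₂ a∈A  = rare a∈A

    pool-edges : VSet → ℕ
    pool-edges P = sum (λ v → count (λ b → P b ∧ adj v b))

    pool-edges-large : ∀ {A P} → Stage₁ A P → n * count P ≤ R * pool-edges P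
    pool-edges-large {P = P} I = begin
      n * count P                                  ≡⟨ *-distribˡ-sum n (λ b → ⟦ P b ⟧) ⟩
      sum (λ b → n * ⟦ P b ⟧)                      ≤⟨ sum-mono term ⟩
      sum (λ b → R * count (λ v → P b ∧ adj v b))  ≡⟨ *-distribˡ-sum R (λ b → count (λ v → P b ∧ adj v b)) ⟨
      R * sum (λ b → count (λ v → P b ∧ adj v b))  ≡⟨ cong (R *_) (∑-comm (λ b v → ⟦ P b ∧ adj v b ⟧)) ⟩
      R * pool-edges P                             ∎
      where
      open ≤-Reasoning
      term : ∀ b → n * ⟦ P b ⟧ ≤ R * count (λ v → P b ∧ adj v b)
      term b with P b in b∈P
      ... | true  = ≤-trans (≤-reflexive (*-identityʳ n)) (Stage₁.high I b∈P)
      ... | false = subst (_≤ R * count (λ v → false ∧ adj v b)) (sym (*-zeroʳ n)) z≤n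

    pool-edges-split : ∀ (A P : VSet) → pool-edges P ≤
      sum (λ v → count (shrink₁ A P v)) + sum (λ v → sum (λ b → clash₁ A v b))
    pool-edges-split A P = begin
      pool-edges P
        ≤⟨ sum-mono (λ v → sum-mono (λ b → split v b)) ⟩
      sum (λ v → sum (λ b → ⟦ shrink₁ A P v b ⟧ + clash₁ A v b))
        ≡⟨ ∑∑-distrib-+ (λ v b → ⟦ shrink₁ A P v b ⟧) (clash₁ A) ⟩
      sum (λ v → count (shrink₁ A P v)) + sum (λ v → sum (λ b → clash₁ A v b)) ∎
      where
      open ≤-Reasoning
      split : ∀ v b → ⟦ P b ∧ adj v b ⟧ ≤ ⟦ shrink₁ A P v b ⟧ + clash₁ A v b
      split v b = ≤-trans (filter-split (P b) (adj v b) (clash₁ A v b))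
        (+-monoʳ-≤ _ (≤-trans (*-monoˡ-≤ _ (⟦⟧≤1 (P b ∧ adj v b))) (≤-reflexive (*-identityˡ _))))

    clashes-in : ∀ (A : VSet) → sum (λ v → sum (λ b → count (λ a → A a ∧ forb a b v))) ≤ n * (count A * m)
    clashes-in A = begin
      sum (λ v → sum (λ b → count (λ a → A a ∧ forb a b v)))
        ≡⟨ ∑-rotate (λ v b a → ⟦ A a ∧ forb a b v ⟧) ⟩
      sum (λ b → sum (λ a → count (λ v → A a ∧ forb a b v)))
        ≡⟨ sum-cong-≗ (λ b → sum-cong-≗ (λ a → count-∧ˡ (A a) (forb a b))) ⟩
      sum (λ b → sum (λ a → ⟦ A a ⟧ * count (forb a b)))
        ≤⟨ sum-bound _ (λ b → sum-on-support A m (λ a _ → forb-size a b)) ⟩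
      n * (count A * m) ∎
      where open ≤-Reasoning

    clashes-out : ∀ (A : VSet) → sum (λ v → sum (λ b → count (λ a → A a ∧ forb v b a))) ≡ sum (λ a → ⟦ A a ⟧ * pop a)
    clashes-out A = begin
      sum (λ v → sum (λ b → count (λ a → A a ∧ forb v b a)))
        ≡⟨ ∑-rotate (λ a v b → ⟦ A a ∧ forb v b a ⟧) ⟨
      sum (λ a → sum (λ v → count (λ b → A a ∧ forb v b a)))
        ≡⟨ sum-cong-≗ (λ a → sum-cong-≗ (λ v → count-∧ˡ (A a) (λ b → forb v b a))) ⟩
      sum (λ a → sum (λ v → ⟦ A a ⟧ * count (λ b → forb v b a)))
        ≡⟨ sum-cong-≗ (λ a → *-distribˡ-sum ⟦ A a ⟧ (λ v → count (λ b → forb v b a))) ⟨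
      sum (λ a → ⟦ A a ⟧ * pop a) ∎
      where open ≡-Reasoning

    -- Chosen vertices are unpopular, so they lie in few forbidden sets.
    chosen-pop : ∀ {A P} → Stage₁ A P → L * sum (λ a → ⟦ A a ⟧ * pop a) ≤ count A * (n * n)
    chosen-pop {A} I = begin
      L * sum (λ a → ⟦ A a ⟧ * pop a)   ≡⟨ *-distribˡ-sum L (λ a → ⟦ A a ⟧ * pop a) ⟩
      sum (λ a → L * (⟦ A a ⟧ * pop a)) ≡⟨ sum-cong-≗ (λ a → x∙yz≈y∙xz L ⟦ A a ⟧ (pop a)) ⟩
      sum (λ a → ⟦ A a ⟧ * (L * pop a)) ≤⟨ sum-on-support A (n * n) (λ a a∈A → <⇒≤ (unpopular (Stage₁.rare I a∈A))) ⟩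
      count A * (n * n)                 ∎
      where open ≤-Reasoning

    -- Discarding blocked candidates costs at most n per blocked vertex.
    unblocked-sum : ∀ (A P : VSet) → sum (λ v → count (shrink₁ A P v)) ≤
      sum (λ v → ⟦ not (blocked A v) ⟧ * count (shrink₁ A P v)) + (L * m + count A) * n
    unblocked-sum A P = begin
      sum (λ v → count (shrink₁ A P v))
        ≤⟨ sum-mono (λ v → term (blocked A v) (count≤n (shrink₁ A P v))) ⟩
      sum (λ v → g v + ⟦ blocked A v ⟧ * n)
        ≡⟨ ∑-distrib-+ g (λ v → ⟦ blocked A v ⟧ * n) ⟩
      sum g + sum (λ v → ⟦ blocked A v ⟧ * n)
        ≡⟨ cong (sum g +_) (*-distribʳ-sum n (λ v → ⟦ blocked A v ⟧)) ⟨
      sum g + count (blocked A) * n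
        ≤⟨ +-monoʳ-≤ (sum g) (*-monoˡ-≤ n (≤-trans (count-∨ popular A) (+-monoˡ-≤ (count A) popular-few))) ⟩
      sum g + (L * m + count A) * n ∎
      where
      open ≤-Reasoning
      g : Fin n → ℕ
      g v = ⟦ not (blocked A v) ⟧ * count (shrink₁ A P v)
      term : ∀ b {x} → x ≤ n → x ≤ ⟦ not b ⟧ * x + ⟦ b ⟧ * n
      term false {x} _   = ≤-trans (≤-reflexive (sym (+-identityʳ x))) (≤-reflexive (cong (_+ 0) (sym (*-identityˡ x))))
      term true  {x} x≤n = subst (x ≤_) (sym (*-identityˡ n)) x≤n

    clashes-total : ∀ (A : VSet) →
      sum (λ v → sum (clash₁ A v)) ≤ n * (count A * m) + sum (λ a → ⟦ A a ⟧ * pop a)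
    clashes-total A = begin
      sum (λ v → sum (clash₁ A v))
        ≡⟨ ∑∑-distrib-+ (λ v b → count (λ a → A a ∧ forb a b v)) (λ v b → count (λ a → A a ∧ forb v b a)) ⟩
      sum (λ v → sum (λ b → count (λ a → A a ∧ forb a b v)))
        + sum (λ v → sum (λ b → count (λ a → A a ∧ forb v b a)))
        ≤⟨ +-mono-≤ (clashes-in A) (≤-reflexive (clashes-out A)) ⟩
      n * (count A * m) + sum (λ a → ⟦ A a ⟧ * pop a) ∎
      where open ≤-Reasoning

    gain : VSet → VSet → Fin n → ℕ
    gain A P v = ⟦ not (blocked A v) ⟧ * count (shrink₁ A P v)

    best : VSet → VSet → Fin n
    best A P = proj₁ (argmax (gain A P))

    pool-edges-bound : ∀ A P → pool-edges P ≤
      n * gain A P (best A P) + (L * m + count A + count A * m) * n + sum (λ a → ⟦ A a ⟧ * pop a)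
    pool-edges-bound A P = begin
      pool-edges P
        ≤⟨ pool-edges-split A P ⟩
      sum (λ v → count (shrink₁ A P v)) + sum (λ v → sum (clash₁ A v))
        ≤⟨ +-mono-≤ (unblocked-sum A P) (clashes-total A) ⟩
      sum (gain A P) + (L * m + k) * n + (n * (k * m) + E)
        ≤⟨ +-monoˡ-≤ _ (+-monoˡ-≤ _ (sum-bound _ (proj₂ (argmax (gain A P))))) ⟩
      n * gain A P (best A P) + (L * m + k) * n + (n * (k * m) + E)
        ≡⟨ regroup (n * gain A P (best A P)) (L * m + k) (k * m) n E ⟩
      n * gain A P (best A P) + (L * m + k + k * m) * n + E ∎
      where
      open ≤-Reasoning
      k : ℕ
      k = count A
      E : ℕ
      E = sum (λ a → ⟦ A a ⟧ * pop a)
      regroup : ∀ x a b n e → x + a * n + (n * b + e) ≡ x + (a + b) * n + e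
      regroup = solve-∀

    stage₁-step : ∀ {A P} c → Stage₁ A P → n ≤ c * count P →
      4 * (R * c) * suc (count A) ≤ L →
      4 * (R * c) * (L * m + count A + count A * m) ≤ n →
      blocked A (best A P) ≡ false × n ≤ 2 * (R * c) * count (shrink₁ A P (best A P))
    stage₁-step {A} {P} c I n≤cP L-large n-large =
      not-true (proj₁ chosen) , proj₂ chosen
      where
      open ≤-Reasoning
      k : ℕ
      k = count A
      W : ℕ
      W = R * c
      v = best A P
      E₁ : ℕ
      E₁ = (L * m + k + k * m) * n
      E₂ : ℕ
      E₂ = sum (λ a → ⟦ A a ⟧ * pop a)
      square : n * n ≤ W * (n * gain A P v + E₁ + E₂)
      square = begin
        n * n                   ≤⟨ *-monoʳ-≤ n n≤cP ⟩
        n * (c * count P)       ≡⟨ x∙yz≈y∙xz n c (count P) ⟩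
        c * (n * count P)       ≤⟨ *-monoʳ-≤ c (pool-edges-large I) ⟩
        c * (R * pool-edges P)  ≡⟨ x∙yz≈y∙xz c R (pool-edges P) ⟩
        R * (c * pool-edges P)  ≡⟨ *-assoc R c (pool-edges P) ⟨
        W * pool-edges P        ≤⟨ *-monoʳ-≤ W (pool-edges-bound A P) ⟩
        W * (n * gain A P v + E₁ + E₂) ∎
      small₁ : 4 * (W * E₁) ≤ n * n
      small₁ = ≤-trans (≤-reflexive (reassoc 4 W (L * m + k + k * m) n)) (*-monoˡ-≤ n n-large)
        where
        reassoc : ∀ a b c d → a * (b * (c * d)) ≡ a * b * c * d
        reassoc = solve-∀
      small₂ : 4 * (W * E₂) ≤ n * n
      small₂ = *-cancelˡ-≤ (suc k) (begin
        suc k * (4 * (W * E₂))   ≡⟨ reorder (suc k) W E₂ ⟩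
        4 * W * suc k * E₂       ≤⟨ *-monoˡ-≤ E₂ L-large ⟩
        L * E₂                   ≤⟨ chosen-pop I ⟩
        k * (n * n)              ≤⟨ *-monoˡ-≤ (n * n) (n≤1+n k) ⟩
        suc k * (n * n)          ∎)
        where
        reorder : ∀ a b e → a * (4 * (b * e)) ≡ 4 * b * a * e
        reorder = solve-∀
      chosen : not (blocked A v) ≡ true × n ≤ 2 * W * count (shrink₁ A P v)
      chosen = positive-indicator (not (blocked A v)) (2 * W * count (shrink₁ A P v))
        (subst (n ≤_) (x∙yz≈y∙xz (2 * W) ⟦ not (blocked A v) ⟧ _) (absorb n W (gain A P v) E₁ E₂ square small₁ small₂))

    high-degree : VSet
    high-degree b = n ≤ᵇ R * deg b

    high-degree-many : 2 * (n * n) ≤ R * sum deg → n ≤ R * count high-degree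
    high-degree-many total = *-cancelˡ-≤ n (+-cancelʳ-≤ (n * n) _ _ (begin
      n * n + n * n                                    ≡⟨ double (n * n) ⟩
      2 * (n * n)                                      ≤⟨ total ⟩
      R * sum deg                                      ≡⟨ *-distribˡ-sum R deg ⟩
      sum (λ b → R * deg b)                            ≤⟨ sum-mono term ⟩
      sum (λ b → R * n * ⟦ high-degree b ⟧ + n)        ≡⟨ ∑-distrib-+ (λ b → R * n * ⟦ high-degree b ⟧) (λ _ → n) ⟩
      sum (λ b → R * n * ⟦ high-degree b ⟧) + sum {n} (λ _ → n)
        ≡⟨ cong₂ _+_ (sym (*-distribˡ-sum (R * n) (λ b → ⟦ high-degree b ⟧))) (sum-const {n} n) ⟩
      R * n * count high-degree + n * n                ≡⟨ cong (_+ n * n) (reorder R n (count high-degree)) ⟩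
      n * (R * count high-degree) + n * n              ∎))
      where
      open ≤-Reasoning
      double : ∀ x → x + x ≡ 2 * x
      double = solve-∀
      reorder : ∀ R n c → R * n * c ≡ n * (R * c)
      reorder = solve-∀
      term : ∀ b → R * deg b ≤ R * n * ⟦ high-degree b ⟧ + n
      term b with n ≤ᵇ R * deg b in high
      ... | true  = ≤-trans (*-monoʳ-≤ R (count≤n (λ v → adj v b)))
                            (≤-trans (≤-reflexive (sym (*-identityʳ (R * n)))) (m≤m+n _ n))
      ... | false = ≤-trans (<⇒≤ (≰⇒> λ le → subst T high (≤⇒≤ᵇ le))) (m≤n+m n _)

    stage₁-start : Stage₁ (λ _ → false) high-degree
    stage₁-start = record
      { high  = λ {b} h → ≤ᵇ⇒≤ n (R * deg b) (subst T (sym h) _)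
      ; edge  = λ ()
      ; avoid = λ ()
      ; rare  = λ () }

    record Reached₁ (k : ℕ) : Set where
      field
        A P        : VSet
        stage      : Stage₁ A P
        size       : count A ≡ k
        pool-large : n ≤ pool-const R k * count P

    reached₁-start : 2 * (n * n) ≤ R * sum deg → Reached₁ 0
    reached₁-start total = record
      { A = λ _ → false ; P = high-degree ; stage = stage₁-start
      ; size = trans (sum-const {n} 0) (*-zeroʳ n)
      ; pool-large = subst (λ c → n ≤ c * count high-degree) (sym (*-identityʳ R)) (high-degree-many total) }

    -- While k < t, the errors are controlled by their values at t.
    reached₁-advance : ∀ {k t} → k < t →
      4 * (R * pool-const R t) * suc t ≤ L →
      4 * (R * pool-const R t) * (L * m + t + t * m) ≤ n →
      Reached₁ k → Reached₁ (suc k)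
    reached₁-advance {k} {t} k<t L-large n-large r = record
      { A = insert v A ; P = shrink₁ A P v ; stage = stage₁-extend stage (proj₁ step)
      ; size = trans (count-insert v A (proj₂ (∨-false (proj₁ step)))) (cong suc size)
      ; pool-large = subst (λ c → n ≤ c * count (shrink₁ A P v)) (pool-const-suc R k) (proj₂ step) }
      where
      open Reached₁ r
      k≤t : k ≤ t
      k≤t = <⇒≤ k<t
      c≤ : R * pool-const R k ≤ R * pool-const R t
      c≤ = *-monoʳ-≤ R (pool-const-mono R k≤t)
      L-ok : 4 * (R * pool-const R k) * suc (count A) ≤ L
      L-ok = subst (λ j → 4 * (R * pool-const R k) * suc j ≤ L) (sym size)
               (≤-trans (*-mono-≤ (*-monoʳ-≤ 4 c≤) (s≤s k≤t)) L-large)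
      n-ok : 4 * (R * pool-const R k) * (L * m + count A + count A * m) ≤ n
      n-ok = subst (λ j → 4 * (R * pool-const R k) * (L * m + j + j * m) ≤ n) (sym size)
               (≤-trans (*-mono-≤ (*-monoʳ-≤ 4 c≤) (+-mono-≤ (+-monoʳ-≤ (L * m) k≤t) (*-monoˡ-≤ m k≤t))) n-large)
      v : Fin n
      v = best A P
      step : blocked A v ≡ false × n ≤ 2 * (R * pool-const R k) * count (shrink₁ A P v)
      step = stage₁-step (pool-const R k) stage pool-large L-ok n-ok

    phase₁ : ∀ t → 2 * (n * n) ≤ R * sum deg →
      4 * (R * pool-const R t) * suc t ≤ L →
      4 * (R * pool-const R t) * (L * m + t + t * m) ≤ n →
      Reached₁ t
    phase₁ t total L-large n-large = go t ≤-refl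
      where
      go : ∀ k → k ≤ t → Reached₁ k
      go zero    _   = reached₁-start total
      go (suc k) k<t = reached₁-advance k<t L-large n-large (go k (<⇒≤ k<t))

  module Phase₂ (A P : VSet) where

    conf : Fin n → Fin n → ℕ
    conf x y = count (λ a → A a ∧ forb a x y)

    -- Obstructions to having both x and y in B.
    clash₂ : Fin n → Fin n → ℕ
    clash₂ x y = ⟦ does (y ≟ x) ⟧ + conf x y + conf y x

    shrink₂ : VSet → Fin n → VSet
    shrink₂ Q x y = Q y ∧ (clash₂ x y ≡ᵇ 0)

    -- The loss of pool per step.
    margin : ℕ
    margin = 1 + 2 * (count A * m)

    record Stage₂ (B Q : VSet) : Set where
      field
        chosen : ∀ {b} → B b ≡ true → P b ≡ true
        pool   : ∀ {y} → Q y ≡ true → P y ≡ true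
        fresh  : ∀ {y} → Q y ≡ true → B y ≡ false
        avoidB : ∀ {a b x} → A a ≡ true → B b ≡ true → B x ≡ true → forb a b x ≡ false
        avoidQ : ∀ {a b y} → A a ≡ true → B b ≡ true → Q y ≡ true →
                 forb a b y ≡ false × forb a y b ≡ false

    stage₂-extend : ∀ {B Q x} → Stage₂ B Q → Q x ≡ true → Stage₂ (insert x B) (shrink₂ Q x)
    stage₂-extend {B} {Q} {x} J x∈Q = record
      { chosen = chosen′
      ; pool   = λ y∈ → pool (in-Q y∈)
      ; fresh  = fresh′
      ; avoidB = avoidB′
      ; avoidQ = avoidQ′ }
      where
      open Stage₂ J
      in-Q : ∀ {y} → shrink₂ Q x y ≡ true → Q y ≡ true
      in-Q y∈ = proj₁ (∧-true y∈)
      no-clash : ∀ {y} → shrink₂ Q x y ≡ true → clash₂ x y ≡ 0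
      no-clash {y} y∈ = ≡ᵇ0⇒≡0 (clash₂ x y) (proj₂ (∧-true {Q y} y∈))
      vanish : ∀ {y} → shrink₂ Q x y ≡ true →
        ⟦ does (y ≟ x) ⟧ ≡ 0 × conf x y ≡ 0 × conf y x ≡ 0
      vanish {y} y∈ =
        m+n≡0⇒m≡0 d (m+n≡0⇒m≡0 (d + conf x y) none) ,
        m+n≡0⇒n≡0 d (m+n≡0⇒m≡0 (d + conf x y) none) ,
        m+n≡0⇒n≡0 (d + conf x y) none
        where
        d : ℕ
        d = ⟦ does (y ≟ x) ⟧
        none : clash₂ x y ≡ 0
        none = no-clash y∈
      distinct : ∀ {y} → shrink₂ Q x y ≡ true → does (y ≟ x) ≡ false
      distinct y∈ = ⟦⟧≡0 (proj₁ (vanish y∈))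
      x-safe : ∀ {a y} → shrink₂ Q x y ≡ true → A a ≡ true → forb a x y ≡ false
      x-safe {y = y} y∈ = count-∧≡0 A (λ a → forb a x y) (proj₁ (proj₂ (vanish y∈)))
      safe-x : ∀ {a y} → shrink₂ Q x y ≡ true → A a ≡ true → forb a y x ≡ false
      safe-x {y = y} y∈ = count-∧≡0 A (λ a → forb a y x) (proj₂ (proj₂ (vanish y∈)))
      chosen′ : ∀ {b} → insert x B b ≡ true → P b ≡ true
      chosen′ {b} b∈ with ∈-insert x B b b∈
      ... | inj₁ refl = pool x∈Q
      ... | inj₂ b∈B  = chosen b∈B
      fresh′ : ∀ {y} → shrink₂ Q x y ≡ true → insert x B y ≡ false
      fresh′ y∈ rewrite distinct y∈ = fresh (in-Q y∈)
      avoidB′ : ∀ {a b z} → A a ≡ true → insert x B b ≡ true → insert x B z ≡ true → forb a b z ≡ false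
      avoidB′ {a} {b} {z} a∈A b∈ z∈ with ∈-insert x B b b∈ | ∈-insert x B z z∈
      ... | inj₁ refl | inj₁ refl = forb-end₂ _ _
      ... | inj₁ refl | inj₂ z∈B  = proj₂ (avoidQ a∈A z∈B x∈Q)
      ... | inj₂ b∈B  | inj₁ refl = proj₁ (avoidQ a∈A b∈B x∈Q)
      ... | inj₂ b∈B  | inj₂ z∈B  = avoidB a∈A b∈B z∈B
      avoidQ′ : ∀ {a b y} → A a ≡ true → insert x B b ≡ true → shrink₂ Q x y ≡ true →
                forb a b y ≡ false × forb a y b ≡ false
      avoidQ′ {a} {b} a∈A b∈ y∈ with ∈-insert x B b b∈
      ... | inj₁ refl = x-safe y∈ a∈A , safe-x y∈ a∈A
      ... | inj₂ b∈B  = avoidQ a∈A b∈B (in-Q y∈)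

    conf-row : ∀ x → sum (conf x) ≤ count A * m
    conf-row x = begin
      sum (λ y → count (λ a → A a ∧ forb a x y))   ≡⟨ ∑-comm (λ y a → ⟦ A a ∧ forb a x y ⟧) ⟩
      sum (λ a → count (λ y → A a ∧ forb a x y))   ≡⟨ sum-cong-≗ (λ a → count-∧ˡ (A a) (forb a x)) ⟩
      sum (λ a → ⟦ A a ⟧ * count (forb a x))       ≤⟨ sum-on-support A m (λ a _ → forb-size a x) ⟩
      count A * m                                  ∎
      where open ≤-Reasoning

    clash-pairs : ∀ (Q : VSet) → sum (λ x → sum (λ y → ⟦ Q x ∧ Q y ⟧ * clash₂ x y)) ≤ count Q * margin
    clash-pairs Q = begin
      sum (λ x → sum (λ y → ⟦ Q x ∧ Q y ⟧ * clash₂ x y))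
        ≤⟨ sum-mono (λ x → sum-mono (λ y → split x y)) ⟩
      sum (λ x → sum (λ y → ⟦ Q x ⟧ * (⟦ does (y ≟ x) ⟧ + conf x y) + ⟦ Q y ⟧ * conf y x))
        ≡⟨ ∑∑-distrib-+ (λ x y → ⟦ Q x ⟧ * (⟦ does (y ≟ x) ⟧ + conf x y)) (λ x y → ⟦ Q y ⟧ * conf y x) ⟩
      sum (λ x → sum (λ y → ⟦ Q x ⟧ * (⟦ does (y ≟ x) ⟧ + conf x y)))
        + sum (λ x → sum (λ y → ⟦ Q y ⟧ * conf y x))
        ≡⟨ cong₂ _+_ (sum-cong-≗ (λ x → sym (*-distribˡ-sum ⟦ Q x ⟧ (λ y → ⟦ does (y ≟ x) ⟧ + conf x y))))
                     (∑-comm (λ x y → ⟦ Q y ⟧ * conf y x)) ⟩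
      sum (λ x → ⟦ Q x ⟧ * sum (λ y → ⟦ does (y ≟ x) ⟧ + conf x y))
        + sum (λ y → sum (λ x → ⟦ Q y ⟧ * conf y x))
        ≡⟨ cong₂ _+_ (sum-cong-≗ (λ x → cong (⟦ Q x ⟧ *_) (∑-distrib-+ (λ y → ⟦ does (y ≟ x) ⟧) (conf x))))
                     (sum-cong-≗ (λ y → sym (*-distribˡ-sum ⟦ Q y ⟧ (conf y)))) ⟩
      sum (λ x → ⟦ Q x ⟧ * (count (λ y → does (y ≟ x)) + sum (conf x)))
        + sum (λ y → ⟦ Q y ⟧ * sum (conf y))
        ≤⟨ +-mono-≤ (sum-on-support Q (1 + count A * m)
                       (λ x _ → ≤-trans (≤-reflexive (cong (_+ sum (conf x)) (count-singleton x)))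
                                        (+-monoʳ-≤ 1 (conf-row x))))
                    (sum-on-support Q (count A * m) (λ y _ → conf-row y)) ⟩
      count Q * (1 + count A * m) + count Q * (count A * m)
        ≡⟨ regroup (count Q) (count A * m) ⟩
      count Q * margin ∎
      where
      open ≤-Reasoning
      regroup : ∀ q s → q * (1 + s) + q * s ≡ q * (1 + 2 * s)
      regroup = solve-∀
      split : ∀ x y → ⟦ Q x ∧ Q y ⟧ * clash₂ x y ≤ ⟦ Q x ⟧ * (⟦ does (y ≟ x) ⟧ + conf x y) + ⟦ Q y ⟧ * conf y x
      split x y with Q x | Q y
      ... | false | _     = z≤n
      ... | true  | false = z≤n
      ... | true  | true  = ≤-reflexive (distrib (⟦ does (y ≟ x) ⟧ + conf x y) (conf y x))
        where
        distrib : ∀ a b → 1 * (a + b) ≡ 1 * a + 1 * b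
        distrib = solve-∀

    -- Averaging over x ∈ Q: some x keeps all but margin of the pool.
    stage₂-step : ∀ (Q : VSet) → ∃ λ x → count Q ≤ ⟦ Q x ⟧ * count (shrink₂ Q x) + margin
    stage₂-step Q = x , square-cancel (count Q) (g x + margin) (begin
      count Q * count Q
        ≡⟨ *-distribʳ-sum (count Q) (λ x → ⟦ Q x ⟧) ⟩
      sum (λ x → ⟦ Q x ⟧ * count Q)
        ≡⟨ sum-cong-≗ (λ x → count-∧ˡ (Q x) Q) ⟨
      sum (λ x → count (λ y → Q x ∧ Q y))
        ≤⟨ sum-mono (λ x → sum-mono (λ y → filter-split (Q x) (Q y) (clash₂ x y))) ⟩
      sum (λ x → sum (λ y → ⟦ Q x ∧ shrink₂ Q x y ⟧ + ⟦ Q x ∧ Q y ⟧ * clash₂ x y))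
        ≡⟨ ∑∑-distrib-+ (λ x y → ⟦ Q x ∧ shrink₂ Q x y ⟧) (λ x y → ⟦ Q x ∧ Q y ⟧ * clash₂ x y) ⟩
      sum (λ x → count (λ y → Q x ∧ shrink₂ Q x y)) + clashes
        ≡⟨ cong (_+ clashes) (sum-cong-≗ (λ x → count-∧ˡ (Q x) (shrink₂ Q x))) ⟩
      sum (λ x → ⟦ Q x ⟧ * count (shrink₂ Q x)) + clashes
        ≤⟨ +-mono-≤ (sum-on-support Q (g x) kept) (clash-pairs Q) ⟩
      count Q * g x + count Q * margin
        ≡⟨ *-distribˡ-+ (count Q) (g x) margin ⟨
      count Q * (g x + margin) ∎)
      where
      open ≤-Reasoning
      g : Fin n → ℕ
      g x = ⟦ Q x ⟧ * count (shrink₂ Q x)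
      x : Fin n
      x = proj₁ (argmax g)
      clashes : ℕ
      clashes = sum (λ x → sum (λ y → ⟦ Q x ∧ Q y ⟧ * clash₂ x y))
      kept : ∀ x′ → Q x′ ≡ true → count (shrink₂ Q x′) ≤ g x
      kept x′ x′∈Q = ≤-trans
        (subst (λ b → count (shrink₂ Q x′) ≤ ⟦ b ⟧ * count (shrink₂ Q x′)) (sym x′∈Q)
               (≤-reflexive (sym (+-identityʳ _))))
        (proj₂ (argmax g) x′)

    record Reached₂ (k : ℕ) : Set where
      field
        B Q        : VSet
        stage      : Stage₂ B Q
        size       : count B ≡ k
        pool-large : count P ≤ count Q + k * margin

    reached₂-start : Reached₂ 0
    reached₂-start = record
      { B = λ _ → false ; Q = P
      ; stage = record { chosen = λ () ; pool = λ y∈P → y∈P ; fresh = λ _ → refl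
                       ; avoidB = λ _ () ; avoidQ = λ _ () }
      ; size = trans (sum-const {n} 0) (*-zeroʳ n)
      ; pool-large = m≤m+n (count P) 0 }

    -- While k < t, the pool still has more than margin points, so the
    -- chosen x lies in it.
    reached₂-advance : ∀ {k t} → k < t → t * margin + 1 ≤ count P → Reached₂ k → Reached₂ (suc k)
    reached₂-advance {k} {t} k<t P-large r = record
      { B = insert x B ; Q = shrink₂ Q x ; stage = stage₂-extend stage x∈Q
      ; size = trans (count-insert x B (Stage₂.fresh stage x∈Q)) (cong suc size)
      ; pool-large = begin
          count P                                ≤⟨ pool-large ⟩
          count Q + k * margin                   ≤⟨ +-monoˡ-≤ (k * margin) kept ⟩
          count (shrink₂ Q x) + margin + k * margin ≡⟨ +-assoc (count (shrink₂ Q x)) margin (k * margin) ⟩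
          count (shrink₂ Q x) + suc k * margin   ∎ }
      where
      open Reached₂ r
      open ≤-Reasoning
      x : Fin n
      x = proj₁ (stage₂-step Q)
      c : ℕ
      c = count (shrink₂ Q x)
      reorder : ∀ e k → 1 + e + k * e ≡ suc k * e + 1
      reorder = solve-∀
      enough : 1 + margin ≤ count Q
      enough = +-cancelʳ-≤ (k * margin) (1 + margin) (count Q) (begin
        1 + margin + k * margin   ≡⟨ reorder margin k ⟩
        suc k * margin + 1        ≤⟨ +-monoˡ-≤ 1 (*-monoˡ-≤ margin k<t) ⟩
        t * margin + 1            ≤⟨ P-large ⟩
        count P                   ≤⟨ pool-large ⟩
        count Q + k * margin      ∎)
      positive : 1 ≤ ⟦ Q x ⟧ * c
      positive = +-cancelʳ-≤ margin 1 (⟦ Q x ⟧ * c) (≤-trans enough (proj₂ (stage₂-step Q)))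
      x∈Q : Q x ≡ true
      x∈Q = proj₁ (positive-indicator (Q x) c positive)
      kept : count Q ≤ c + margin
      kept = ≤-trans (subst (λ b → count Q ≤ ⟦ b ⟧ * c + margin) x∈Q (proj₂ (stage₂-step Q)))
                     (≤-reflexive (cong (_+ margin) (+-identityʳ c)))

    phase₂ : ∀ t → t * margin + 1 ≤ count P → Reached₂ t
    phase₂ t P-large = go t ≤-refl
      where
      go : ∀ k → k ≤ t → Reached₂ k
      go zero    _   = reached₂-start
      go (suc k) k<t = reached₂-advance k<t P-large (go k (<⇒≤ k<t))

  biclique : ∀ R {{_ : NonZero R}} t → 2 * (n * n) ≤ R * sum deg →
    4 * (R * pool-const R t) * (4 * (R * pool-const R t) * suc t * m + t + t * m) ≤ n →
    pool-const R t * (t * (1 + 2 * (t * m)) + 1) ≤ n →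
    ∃₂ λ A B → count A ≡ t × count B ≡ t × Biclique A B
  biclique R t total n-large₁ n-large₂ = A , B , size , size₂ , record
    { edge    = λ a∈A b∈B → Stage₁.edge stage a∈A (Stage₂.chosen stage₂ b∈B)
    ; avoidsA = λ a∈A b∈B x∈A → Stage₁.avoid stage a∈A (Stage₂.chosen stage₂ b∈B) x∈A
    ; avoidsB = Stage₂.avoidB stage₂ }
    where
    L : ℕ
    L = 4 * (R * pool-const R t) * suc t
    open Phase₁ R L
    open Reached₁ (phase₁ t total ≤-refl n-large₁)
    open Phase₂ A P
    P-large : t * margin + 1 ≤ count P
    P-large = *-cancelˡ-≤ (pool-const R t) {{pool-const-nonZero R t}}
      (≤-trans (subst (λ j → pool-const R t * (t * (1 + 2 * (j * m)) + 1) ≤ n) (sym size) n-large₂) pool-large)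
    open Reached₂ (phase₂ t P-large) renaming (size to size₂; stage to stage₂)

module PairGraph {n : ℕ} {{_ : NonZero n}} (m : ℕ) (F : List (Subset n)) (S : Subset n → Subset n)
  (F-pairs : ∀ {f} → f L.∈ F → ∣ f ∣ ≡ 2)
  (S-good  : ∀ {f} → f L.∈ F → (∣ S f ∣ ≡ m) × (S f ∩ f ≡ ⊥))
  where

  adj : Fin n → Fin n → Bool
  adj u v = does (pair u v ∈ˡ? F)

  forb : Fin n → Fin n → Fin n → Bool
  forb u v x = adj u v ∧ does (x ∈? S (pair u v))

  forb-size : ∀ u v → count (forb u v) ≤ m
  forb-size u v = ≤-trans (≤-reflexive (count-∧ˡ (adj u v) (λ x → does (x ∈? S (pair u v))))) (on-edge u v)
    where
    on-edge : ∀ u v → ⟦ adj u v ⟧ * count (λ x → does (x ∈? S (pair u v))) ≤ m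
    on-edge u v with adj u v in uv∈F
    ... | true  = ≤-reflexive (trans (+-identityʳ _)
                    (trans (sym (∣∣≡count (S (pair u v)))) (proj₁ (S-good (∈ˡ-sound uv∈F)))))
    ... | false = z≤n

  forb-end : ∀ u v {x} → x ∈ pair u v → adj u v ∧ does (x ∈? S (pair u v)) ≡ false
  forb-end u v {x} x∈uv with adj u v in uv∈F
  ... | true  = dec-false (x ∈? S (pair u v)) (∉-disjoint (proj₂ (S-good (∈ˡ-sound uv∈F))) x∈uv)
  ... | false = refl

  open Greedy adj forb m forb-size (λ u v → forb-end u v (∈pair₁ u v)) (λ u v → forb-end u v (∈pair₂ u v))
    public

  dense⇒degrees : ∀ p q → Unique F → suc p * (n * n) ≤ suc q * length F →
    2 * (n * n) ≤ 2 * suc q * sum deg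
  dense⇒degrees p q unique dense = begin
    2 * (n * n)                             ≤⟨ *-monoʳ-≤ 2 (≤-trans (m≤n*m (n * n) (suc p)) dense) ⟩
    2 * (suc q * length F)                  ≤⟨ *-monoʳ-≤ 2 (*-monoʳ-≤ (suc q) F≤pairs) ⟩
    2 * (suc q * sum (λ u → count (adj u))) ≡⟨ *-assoc 2 (suc q) _ ⟨
    2 * suc q * sum (λ u → count (adj u))   ≡⟨ cong (2 * suc q *_) (∑-comm (λ u v → ⟦ adj u v ⟧)) ⟩
    2 * suc q * sum deg                     ∎
    where
    open ≤-Reasoning
    F≤pairs : length F ≤ sum (λ u → count (adj u))
    F≤pairs = handshake F unique (λ f∈F → size2⇒pair _ (F-pairs f∈F))

  realise : ∀ {t} → (∃₂ λ A B → count A ≡ t × count B ≡ t × Biclique A B) →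
    ∃ λ (A′ : Subset n) → ∃ λ (B′ : Subset n) →
      (A′ ∩ B′ ≡ ⊥) × (∣ A′ ∣ ≡ t) × (∣ B′ ∣ ≡ t) ×
      (∀ a b → a ∈ A′ → b ∈ B′ → (pair a b L.∈ F) × (S (pair a b) ∩ (A′ ∪ B′) ≡ ⊥))
  realise (A , B , |A| , |B| , K) =
    tabulate A , tabulate B , disjoint , trans (∣tabulate∣ A) |A| , trans (∣tabulate∣ B) |B| , spans
    where
    open Biclique K
    -- An edge joins distinct vertices, so A and B are disjoint.
    disjoint : tabulate A ∩ tabulate B ≡ ⊥
    disjoint = ∩≡⊥ (tabulate A) (tabulate B) λ {x} x∈A x∈B →
      pair-distinct {a = x} (F-pairs (∈ˡ-sound (edge (∈-tabulate A x∈A) (∈-tabulate B x∈B)))) refl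
    spans : ∀ a b → a ∈ tabulate A → b ∈ tabulate B →
      (pair a b L.∈ F) × (S (pair a b) ∩ (tabulate A ∪ tabulate B) ≡ ⊥)
    spans a b a∈ b∈ = ∈ˡ-sound ab∈F , ∩≡⊥ (S (pair a b)) (tabulate A ∪ tabulate B) avoided
      where
      a∈A : A a ≡ true
      a∈A = ∈-tabulate A a∈
      b∈B : B b ≡ true
      b∈B = ∈-tabulate B b∈
      ab∈F : adj a b ≡ true
      ab∈F = edge a∈A b∈B
      allowed : ∀ {x} → x ∈ S (pair a b) → forb a b x ≡ false → Empty
      allowed {x} x∈S free = contradiction (trans (sym free) forbidden) λ ()
        where
        forbidden : forb a b x ≡ true
        forbidden = cong₂ _∧_ ab∈F (dec-true (x ∈? S (pair a b)) x∈S)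
      avoided : ∀ {x} → x ∈ S (pair a b) → x ∈ tabulate A ∪ tabulate B → Empty
      avoided x∈S x∈A∪B with x∈p∪q⁻ (tabulate A) (tabulate B) x∈A∪B
      ... | inj₁ x∈A = allowed x∈S (avoidsA a∈A b∈B (∈-tabulate A x∈A))
      ... | inj₂ x∈B = allowed x∈S (avoidsB a∈A b∈B (∈-tabulate B x∈B))

-- With R = 2 (q + 1), the construction applies as soon as n exceeds
-- the two thresholds K₁ (phase 1) and K₂ (phase 2).
lemma4p1 : (m t p q : ℕ) →
    ∃ λ (n₀ : ℕ) → ∀ (n : ℕ) → n ≥ n₀ →
      (H : TripleSystem n) →
      (F : List (Subset n)) → Unique F →
      (∀ {f} → f L.∈ F → f ∈∂ H) →
      (S : Subset n → Subset n) →
      (∀ {f} → f L.∈ F → (∣ S f ∣ ≡ m) × (S f ∩ f ≡ ⊥)) →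
      suc p * (n * n) ≤ suc q * length F →
      ∃ λ (A : Subset n) → ∃ λ (B : Subset n) →
        (A ∩ B ≡ ⊥) × (∣ A ∣ ≡ t) × (∣ B ∣ ≡ t) ×
        (∀ a b → a ∈ A → b ∈ B →
          (pair a b L.∈ F) × (S (pair a b) ∩ (A ∪ B) ≡ ⊥))
lemma4p1 m t p q = suc (K₁ + K₂) , λ
  { zero ()
  ; (suc n′) n-large H F unique F⊆∂H S S-good dense →
      let open PairGraph m F S (λ f∈F → proj₁ (F⊆∂H f∈F)) S-good
          K≤n : K₁ + K₂ ≤ suc n′
          K≤n = ≤-trans (n≤1+n (K₁ + K₂)) n-large
      in realise (biclique R t (dense⇒degrees p q unique dense)
                   (≤-trans (m≤m+n K₁ K₂) K≤n) (≤-trans (m≤n+m K₂ K₁) K≤n)) }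
  where
  R : ℕ
  R = 2 * suc q
  c : ℕ
  c = pool-const R t
  K₁ : ℕ
  K₁ = 4 * (R * c) * (4 * (R * c) * suc t * m + t + t * m)
  K₂ : ℕ
  K₂ = c * (t * (1 + 2 * (t * m)) + 1)
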